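{- For every fixed integer $k\ge 3$, $f(s,k)\le g(k)+\frac{\binom k2}{s}+\Theta\left(\frac1{s^2}\right)$ as $s\to\infty$.
   Context: Let $\Sigma_s=\{0,\ldots,s-1\}$ with its natural order. For a word $w$ (sequence), subwords are subsequences counted by position sets, monotone if non-decreasing or non-increasing; $m(k,w)$ is the number of monotone $k$-subwords. $f(s,k,n)=\min_{w\in(\Sigma_s)^n}m(k,w)/\binom nk$, $f(s,k)=\lim_{n\to\infty}f(s,k,n)$. $g(k,n)$ is the minimum over permutations $\pi$ of $[n]$ of $m(k,\pi)/\binom nk$, and $g(k)=\lim_{n\to\infty}g(k,n)$. The implied constant in the error term depends only on $k$. -}

module Defs where

open import Data.Nat using (ℕ; zero; suc; _≤_; _≤ᵇ_; _⊓_)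
open import Data.Nat.Combinatorics using (_C_)
open import Data.Bool using (Bool; true; false; _∧_; _∨_; if_then_else_)
open import Data.List using (List; []; _∷_; map; _++_; concatMap; length; upTo; filter)
open import Data.Integer using (+_)
open import Data.Rational using (ℚ; _/_; 0ℚ)
open import Relation.Nullary.Decidable using (⌊_⌋)

-- Words over Σ_s = {0,…,s-1} are lists of naturals with entries < s.

-- All subwords of a word, counted by position sets: each of the 2^|w|
-- choices of positions yields one list (duplicates kept).
subwords : List ℕ → List (List ℕ)
subwords []       = [] ∷ []
subwords (x ∷ xs) = let r = subwords xs in map (x ∷_) r ++ r

nondecr : List ℕ → Bool
nondecr []           = true
nondecr (x ∷ [])     = true
nondecr (x ∷ y ∷ xs) = (x ≤ᵇ y) ∧ nondecr (y ∷ xs)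

nonincr : List ℕ → Bool
nonincr []           = true
nonincr (x ∷ [])     = true
nonincr (x ∷ y ∷ xs) = (y ≤ᵇ x) ∧ nonincr (y ∷ xs)

monotone : List ℕ → Bool
monotone u = nondecr u ∨ nonincr u

lenIs : ℕ → List ℕ → Bool
lenIs zero    []       = true
lenIs zero    (_ ∷ _)  = false
lenIs (suc k) []       = false
lenIs (suc k) (_ ∷ xs) = lenIs k xs

countTrue : List Bool → ℕ
countTrue []            = 0
countTrue (true ∷ bs)   = suc (countTrue bs)
countTrue (false ∷ bs)  = countTrue bs

m : ℕ → List ℕ → ℕ
m k w = countTrue (map (λ u → lenIs k u ∧ monotone u) (subwords w))

words : ℕ → ℕ → List (List ℕ)
words s zero    = [] ∷ []
words s (suc n) = concatMap (λ a → map (a ∷_) (words s n)) (upTo s)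

insertions : ℕ → List ℕ → List (List ℕ)
insertions x []       = (x ∷ []) ∷ []
insertions x (y ∷ ys) = (x ∷ y ∷ ys) ∷ map (y ∷_) (insertions x ys)

perms : List ℕ → List (List ℕ)
perms []       = [] ∷ []
perms (x ∷ xs) = concatMap (insertions x) (perms xs)

minList : List ℕ → ℕ
minList []       = 0
minList (x ∷ []) = x
minList (x ∷ xs@(_ ∷ _)) = x ⊓ minList xs

-- a / b as a rational, with the (unused) convention a / 0 = 0
ratio : ℕ → ℕ → ℚ
ratio a zero    = 0ℚ
ratio a (suc b) = (+ a) / suc b

f : ℕ → ℕ → ℕ → ℚ
f s k n = ratio (minList (map (m k) (words s n))) (n C k)

-- g(k,n) = min over permutations π of [n] of m(k,π) / C(n,k)
-- ([n] represented as 0,…,n-1; only the relative order matters)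
g : ℕ → ℕ → ℚ
g k n = ratio (minList (map (m k) (perms (upTo n)))) (n C k)

-- Compress a permutation π of {0,…,N−1} minimising m(k,·) to the word v ↦ ⌊v/q⌋ over Σ_s,
-- where q = ⌊(N−1)/s⌋ + 1 is the least block size with N ≤ s q.  Compression is monotone,
-- so a k-subword that is monotone after compression but not before contains two positions
-- in the same block.  Blocks have at most q elements, giving at most (q−1)N/2 ≤ N(N−1)/(2s)
-- such pairs, each lying in C(N−2,k−2) of the k-subwords; as N(N−1)C(N−2,k−2) = k(k−1)C(N,k),
-- f(s,k,N) ≤ g(k,N) + C(k,2)/s holds for every N ≥ 2.

module Submission where

open import Defs
open import Data.Bool using (Bool; true; false; _∧_; _∨_; T; T?)
open import Data.Bool.Properties using (T-∧; T-∨; ∧-distribˡ-∨; ∧-identityʳ)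
open import Data.Empty using (⊥-elim)
import Data.Integer as ℤ
import Data.Integer.Properties as ℤ
open import Data.List using (List; []; _∷_; map; _++_; length; upTo)
open import Data.List.Properties using (map-∘; map-cong; map-++; length-map; length-upTo; upTo-∷ʳ)
open import Data.List.Membership.Propositional using (_∈_; find; lose)
open import Data.List.Membership.Propositional.Properties
  using (∈-concatMap⁺; ∈-concatMap⁻; ∈-map⁺; ∈-map⁻; ∈-upTo⁺; ∈-upTo⁻)
open import Data.List.Relation.Binary.Permutation.Propositional using (_↭_; prep; swap; ↭-refl; ↭-trans)
open import Data.List.Relation.Binary.Permutation.Propositional.Properties using (∈-resp-↭; ↭-length; map⁺)
open import Data.List.Relation.Unary.Any using (here; there)
open import Data.Nat
open import Data.Nat.ListAction using (sum)
open import Data.Nat.Combinatorics using (_C_; nCk+nC[k+1]≡[n+1]C[k+1]; nC1≡n)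
open import Data.Nat.DivMod using (_/_; _%_; m/n*n≤m; m≡m%n+[m/n]*n; m%n<n; m<n*o⇒m/o<n; /-monoˡ-≤)
open import Data.Nat.Properties
open import Data.Nat.Tactic.RingSolver using (solve-∀)
open import Data.Product using (∃-syntax; _×_; _,_; proj₁; proj₂)
open import Data.Rational as ℚ using (0ℚ; toℚᵘ)
import Data.Rational.Properties as ℚ
import Data.Rational.Unnormalised as ℚᵘ
import Data.Rational.Unnormalised.Properties as ℚᵘ
open import Data.Sum using (inj₁; inj₂)
open import Function using (_∘_; Equivalence)
open import Relation.Binary.PropositionalEquality
open import Relation.Nullary using (¬_; yes; no)

open Equivalence using (to; from)

indicator : Bool → ℕ
indicator true  = 1
indicator false = 0

count : {A : Set} → (A → Bool) → List A → ℕ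
count p xs = countTrue (map p xs)

module _ {A : Set} where

  count-∷ : ∀ (p : A → Bool) x xs → count p (x ∷ xs) ≡ indicator (p x) + count p xs
  count-∷ p x xs with p x
  ... | true  = refl
  ... | false = refl

  count-++ : ∀ (p : A → Bool) xs ys → count p (xs ++ ys) ≡ count p xs + count p ys
  count-++ p []       ys = refl
  count-++ p (x ∷ xs) ys rewrite count-∷ p x (xs ++ ys) | count-∷ p x xs | count-++ p xs ys =
    sym (+-assoc (indicator (p x)) _ _)

  count-map : ∀ {B : Set} (p : B → Bool) (g : A → B) xs → count p (map g xs) ≡ count (p ∘ g) xs
  count-map p g xs = cong countTrue (sym (map-∘ xs))

  count-cong : ∀ {p q : A → Bool} → (∀ x → p x ≡ q x) → ∀ xs → count p xs ≡ count q xs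
  count-cong p≗q xs = cong countTrue (map-cong p≗q xs)

  count-≡0 : ∀ {p : A → Bool} → (∀ x → p x ≡ false) → ∀ xs → count p xs ≡ 0
  count-≡0 p≗false []       = refl
  count-≡0 {p} p≗false (x ∷ xs) rewrite count-∷ p x xs | p≗false x = count-≡0 p≗false xs

  count-mono : ∀ {p q : A → Bool} → (∀ x → T (p x) → T (q x)) → ∀ xs → count p xs ≤ count q xs
  count-mono         p⇒q []       = z≤n
  count-mono {p} {q} p⇒q (x ∷ xs) rewrite count-∷ p x xs | count-∷ q x xs =
    +-mono-≤ (indicator-mono (p x) (q x) (p⇒q x)) (count-mono p⇒q xs)
    where
    indicator-mono : ∀ a b → (T a → T b) → indicator a ≤ indicator b
    indicator-mono true  true  _   = ≤-refl
    indicator-mono true  false a⇒b = ⊥-elim (a⇒b _)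
    indicator-mono false _     _   = z≤n

  count-∨ : ∀ (p q : A → Bool) xs → count (λ x → p x ∨ q x) xs ≤ count p xs + count q xs
  count-∨ p q []       = z≤n
  count-∨ p q (x ∷ xs) rewrite count-∷ (λ x → p x ∨ q x) x xs | count-∷ p x xs | count-∷ q x xs =
    begin
      indicator (p x ∨ q x) + count (λ x → p x ∨ q x) xs
        ≤⟨ +-mono-≤ (indicator-∨ (p x) (q x)) (count-∨ p q xs) ⟩
      (indicator (p x) + indicator (q x)) + (count p xs + count q xs)
        ≡⟨ +-interchange (indicator (p x)) (indicator (q x)) (count p xs) (count q xs) ⟩
      (indicator (p x) + count p xs) + (indicator (q x) + count q xs) ∎
    where
    open ≤-Reasoning
    indicator-∨ : ∀ a b → indicator (a ∨ b) ≤ indicator a + indicator b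
    indicator-∨ true  b = s≤s z≤n
    indicator-∨ false b = ≤-refl
    +-interchange : ∀ a b c d → (a + b) + (c + d) ≡ (a + c) + (b + d)
    +-interchange = solve-∀

countTrue-↭ : ∀ {bs cs : List Bool} → bs ↭ cs → countTrue bs ≡ countTrue cs
countTrue-↭ _↭_.refl              = refl
countTrue-↭ (prep true  p)        = cong suc (countTrue-↭ p)
countTrue-↭ (prep false p)        = countTrue-↭ p
countTrue-↭ (swap true  true  p)  = cong (suc ∘ suc) (countTrue-↭ p)
countTrue-↭ (swap true  false p)  = cong suc (countTrue-↭ p)
countTrue-↭ (swap false true  p)  = cong suc (countTrue-↭ p)
countTrue-↭ (swap false false p)  = countTrue-↭ p
countTrue-↭ (_↭_.trans p q)       = trans (countTrue-↭ p) (countTrue-↭ q)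

count-↭ : ∀ {A : Set} (p : A → Bool) {xs ys} → xs ↭ ys → count p xs ≡ count p ys
count-↭ p xs↭ys = countTrue-↭ (map⁺ p xs↭ys)

subwords-map : ∀ (h : ℕ → ℕ) w → subwords (map h w) ≡ map (map h) (subwords w)
subwords-map h []      = refl
subwords-map h (x ∷ w) = begin
  map (h x ∷_) (subwords (map h w)) ++ subwords (map h w)
    ≡⟨ cong (λ S → map (h x ∷_) S ++ S) (subwords-map h w) ⟩
  map (h x ∷_) (map (map h) S) ++ map (map h) S
    ≡⟨ cong (_++ map (map h) S) (trans (sym (map-∘ S)) (map-∘ S)) ⟩
  map (map h) (map (x ∷_) S) ++ map (map h) S
    ≡⟨ sym (map-++ (map h) (map (x ∷_) S) S) ⟩
  map (map h) (map (x ∷_) S ++ S) ∎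
  where
  open ≡-Reasoning
  S = subwords w

lenIs-map : ∀ (h : ℕ → ℕ) k u → lenIs k (map h u) ≡ lenIs k u
lenIs-map h zero    []      = refl
lenIs-map h zero    (_ ∷ _) = refl
lenIs-map h (suc k) []      = refl
lenIs-map h (suc k) (_ ∷ u) = lenIs-map h k u

count-subwords-∷ : ∀ (p : List ℕ → Bool) x w →
  count p (subwords (x ∷ w)) ≡ count (p ∘ (x ∷_)) (subwords w) + count p (subwords w)
count-subwords-∷ p x w = trans (count-++ p (map (x ∷_) (subwords w)) (subwords w))
                               (cong (_+ count p (subwords w)) (count-map p (x ∷_) (subwords w)))

count-lenIs-subwords : ∀ k w → count (lenIs k) (subwords w) ≡ length w C k
count-lenIs-subwords zero    []      = refl
count-lenIs-subwords (suc k) []      = refl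
count-lenIs-subwords zero    (x ∷ w)
  rewrite count-subwords-∷ (lenIs 0) x w
        | count-≡0 {p = lenIs 0 ∘ (x ∷_)} (λ _ → refl) (subwords w)
        = count-lenIs-subwords 0 w
count-lenIs-subwords (suc k) (x ∷ w)
  rewrite count-subwords-∷ (lenIs (suc k)) x w
        | count-lenIs-subwords k w
        | count-lenIs-subwords (suc k) w
        = nCk+nC[k+1]≡[n+1]C[k+1] (length w) k

C-suc-≤ : ∀ n k → n C k ≤ suc n C k
C-suc-≤ n zero    = ≤-refl
C-suc-≤ n (suc k) = begin
  n C suc k               ≤⟨ m≤n+m (n C suc k) (n C k) ⟩
  n C k + n C suc k       ≡⟨ nCk+nC[k+1]≡[n+1]C[k+1] n k ⟩
  suc n C suc k           ∎
  where open ≤-Reasoning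

C-monoˡ-≤ : ∀ {m n} k → m ≤ n → m C k ≤ n C k
C-monoˡ-≤ {n = zero}  k z≤n = ≤-refl
C-monoˡ-≤ {m} {suc n} k m≤1+n with m ≟ suc n
... | yes refl    = ≤-refl
... | no  m≢1+n = ≤-trans (C-monoˡ-≤ k (≤-pred (≤∧≢⇒< m≤1+n m≢1+n))) (C-suc-≤ n k)

C-pascal-bound : ∀ {a b} c n k → a ≤ c * (n C k) → b ≤ c * (n C suc k) → a + b ≤ c * (suc n C suc k)
C-pascal-bound {a} {b} c n k a≤ b≤ = begin
  a + b                              ≤⟨ +-mono-≤ a≤ b≤ ⟩
  c * (n C k) + c * (n C suc k)      ≡⟨ sym (*-distribˡ-+ c (n C k) (n C suc k)) ⟩
  c * (n C k + n C suc k)            ≡⟨ cong (c *_) (nCk+nC[k+1]≡[n+1]C[k+1] n k) ⟩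
  c * (suc n C suc k)                ∎
  where open ≤-Reasoning

C-absorption : ∀ n k → suc k * (suc n C suc k) ≡ suc n * (n C k)
C-absorption n       zero    = trans (+-identityʳ (suc n C 1)) (trans (nC1≡n (suc n)) (sym (*-identityʳ (suc n))))
C-absorption zero    (suc k) = *-zeroʳ (suc (suc k))
C-absorption (suc n) (suc k) = begin
  suc (suc k) * (suc (suc n) C suc (suc k))
    ≡⟨ cong (suc (suc k) *_) (sym (nCk+nC[k+1]≡[n+1]C[k+1] (suc n) (suc k))) ⟩
  suc (suc k) * (a + b)
    ≡⟨ expand (suc k) a b ⟩
  suc k * a + suc (suc k) * b + a
    ≡⟨ cong₂ (λ u v → u + v + a) (C-absorption n k) (C-absorption n (suc k)) ⟩
  suc n * (n C k) + suc n * (n C suc k) + a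
    ≡⟨ cong (_+ a) (sym (*-distribˡ-+ (suc n) (n C k) (n C suc k))) ⟩
  suc n * (n C k + n C suc k) + a
    ≡⟨ cong (λ z → suc n * z + a) (nCk+nC[k+1]≡[n+1]C[k+1] n k) ⟩
  suc n * a + a
    ≡⟨ +-comm (suc n * a) a ⟩
  suc (suc n) * a ∎
  where
  open ≡-Reasoning
  a = suc n C suc k
  b = suc n C suc (suc k)
  expand : ∀ k a b → suc k * (a + b) ≡ k * a + suc k * b + a
  expand = solve-∀

C-two-absorptions : ∀ n j → suc (suc n) * suc n * (n C j) ≡ suc (suc j) * suc j * (suc (suc n) C suc (suc j))
C-two-absorptions n j = begin
  suc (suc n) * suc n * (n C j)                          ≡⟨ *-assoc (suc (suc n)) (suc n) (n C j) ⟩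
  suc (suc n) * (suc n * (n C j))                        ≡⟨ cong (suc (suc n) *_) (sym (C-absorption n j)) ⟩
  suc (suc n) * (suc j * (suc n C suc j))                ≡⟨ *-left-comm (suc (suc n)) (suc j) (suc n C suc j) ⟩
  suc j * (suc (suc n) * (suc n C suc j))                ≡⟨ cong (suc j *_) (sym (C-absorption (suc n) (suc j))) ⟩
  suc j * (suc (suc j) * (suc (suc n) C suc (suc j)))    ≡⟨ *-left-comm (suc j) (suc (suc j)) (suc (suc n) C suc (suc j)) ⟩
  suc (suc j) * (suc j * (suc (suc n) C suc (suc j)))    ≡⟨ sym (*-assoc (suc (suc j)) (suc j) (suc (suc n) C suc (suc j))) ⟩
  suc (suc j) * suc j * (suc (suc n) C suc (suc j))      ∎
  where
  open ≡-Reasoning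
  *-left-comm : ∀ x y z → x * (y * z) ≡ y * (x * z)
  *-left-comm = solve-∀

two-*-C2 : ∀ j → 2 * (suc (suc j) C 2) ≡ suc (suc j) * suc j
two-*-C2 j = trans (C-absorption (suc j) 1) (cong (suc (suc j) *_) (nC1≡n (suc j)))

≡ᵇ-refl : ∀ a → (a ≡ᵇ a) ≡ true
≡ᵇ-refl zero    = refl
≡ᵇ-refl (suc a) = ≡ᵇ-refl a

≡ᵇ-sym : ∀ a b → (a ≡ᵇ b) ≡ (b ≡ᵇ a)
≡ᵇ-sym zero    zero    = refl
≡ᵇ-sym zero    (suc b) = refl
≡ᵇ-sym (suc a) zero    = refl
≡ᵇ-sym (suc a) (suc b) = ≡ᵇ-sym a b

module _ (h : ℕ → ℕ) where

  hits : ℕ → List ℕ → Bool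
  hits c []       = false
  hits c (y ∷ ys) = (h y ≡ᵇ c) ∨ hits c ys

  hasCollision : List ℕ → Bool
  hasCollision []       = false
  hasCollision (x ∷ xs) = hits (h x) xs ∨ hasCollision xs

  classSize : ℕ → List ℕ → ℕ
  classSize c = count (λ y → h y ≡ᵇ c)

  collisionPairs : List ℕ → ℕ
  collisionPairs []       = 0
  collisionPairs (x ∷ xs) = classSize (h x) xs + collisionPairs xs

  hittingSubwords : ℕ → ℕ → List ℕ → ℕ
  hittingSubwords j c w = count (λ u → lenIs j u ∧ hits c u) (subwords w)

  collidingSubwords : ℕ → List ℕ → ℕ
  collidingSubwords j w = count (λ u → lenIs j u ∧ hasCollision u) (subwords w)

  hittingSubwords-zero : ∀ c w → hittingSubwords 0 c w ≡ 0
  hittingSubwords-zero c w = count-≡0 lenIs0∧ (subwords w)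
    where
    lenIs0∧ : ∀ u → (lenIs 0 u ∧ hits c u) ≡ false
    lenIs0∧ []      = refl
    lenIs0∧ (_ ∷ _) = refl

  hittingSubwords-bound : ∀ j c w → hittingSubwords (suc j) c w ≤ classSize c w * ((length w ∸ 1) C j)
  hittingSubwords-bound j c []       = z≤n
  hittingSubwords-bound j c (y ∷ ys)
    rewrite count-subwords-∷ (λ u → lenIs (suc j) u ∧ hits c u) y ys
    with h y ≡ᵇ c
  ... | true
    rewrite count-cong (λ u → ∧-identityʳ (lenIs j u)) (subwords ys) | count-lenIs-subwords j ys = begin
      length ys C j + hittingSubwords (suc j) c ys
        ≤⟨ +-monoʳ-≤ (length ys C j) (hittingSubwords-bound j c ys) ⟩
      length ys C j + classSize c ys * ((length ys ∸ 1) C j)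
        ≤⟨ +-monoʳ-≤ (length ys C j) (*-monoʳ-≤ (classSize c ys) (C-monoˡ-≤ j (m∸n≤m (length ys) 1))) ⟩
      length ys C j + classSize c ys * (length ys C j) ∎
    where open ≤-Reasoning
  ... | false = pascal j ys
    where
    pascal : ∀ j ys → hittingSubwords j c ys + hittingSubwords (suc j) c ys ≤ classSize c ys * (length ys C j)
    pascal zero ys rewrite hittingSubwords-zero c ys =
      ≤-trans (hittingSubwords-bound 0 c ys) (*-monoʳ-≤ (classSize c ys) (C-monoˡ-≤ 0 (m∸n≤m (length ys) 1)))
    pascal (suc j) []       = z≤n
    pascal (suc j) (z ∷ zs) = C-pascal-bound (classSize c (z ∷ zs)) (length zs) j
      (hittingSubwords-bound j c (z ∷ zs)) (hittingSubwords-bound (suc j) c (z ∷ zs))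

  collidingSubwords-one : ∀ w → collidingSubwords 1 w ≡ 0
  collidingSubwords-one w = count-≡0 lenIs1∧ (subwords w)
    where
    lenIs1∧ : ∀ u → (lenIs 1 u ∧ hasCollision u) ≡ false
    lenIs1∧ []          = refl
    lenIs1∧ (_ ∷ [])    = refl
    lenIs1∧ (_ ∷ _ ∷ _) = refl

  collidingSubwords-bound : ∀ j w → collidingSubwords (suc (suc j)) w ≤ collisionPairs w * ((length w ∸ 2) C j)
  collidingSubwords-bound j []       = z≤n
  collidingSubwords-bound j (x ∷ xs)
    rewrite count-subwords-∷ (λ u → lenIs (suc (suc j)) u ∧ hasCollision u) x xs = begin
      count (λ u → lenIs (suc j) u ∧ (hits (h x) u ∨ hasCollision u)) (subwords xs) + collidingSubwords (suc (suc j)) xs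
        ≡⟨ cong (_+ collidingSubwords (suc (suc j)) xs) (count-cong (λ u → ∧-distribˡ-∨ (lenIs (suc j) u) _ _) (subwords xs)) ⟩
      count (λ u → (lenIs (suc j) u ∧ hits (h x) u) ∨ (lenIs (suc j) u ∧ hasCollision u)) (subwords xs) + collidingSubwords (suc (suc j)) xs
        ≤⟨ +-monoˡ-≤ (collidingSubwords (suc (suc j)) xs) (count-∨ _ _ (subwords xs)) ⟩
      hittingSubwords (suc j) (h x) xs + collidingSubwords (suc j) xs + collidingSubwords (suc (suc j)) xs
        ≡⟨ +-assoc (hittingSubwords (suc j) (h x) xs) _ _ ⟩
      hittingSubwords (suc j) (h x) xs + (collidingSubwords (suc j) xs + collidingSubwords (suc (suc j)) xs)
        ≤⟨ +-mono-≤ (hittingSubwords-bound j (h x) xs) (pascal j xs) ⟩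
      classSize (h x) xs * ((length xs ∸ 1) C j) + collisionPairs xs * ((length xs ∸ 1) C j)
        ≡⟨ sym (*-distribʳ-+ ((length xs ∸ 1) C j) (classSize (h x) xs) (collisionPairs xs)) ⟩
      collisionPairs (x ∷ xs) * ((length xs ∸ 1) C j) ∎
    where
    open ≤-Reasoning
    pascal : ∀ j xs → collidingSubwords (suc j) xs + collidingSubwords (suc (suc j)) xs
                        ≤ collisionPairs xs * ((length xs ∸ 1) C j)
    pascal zero xs rewrite collidingSubwords-one xs =
      ≤-trans (collidingSubwords-bound 0 xs)
              (*-monoʳ-≤ (collisionPairs xs) (C-monoˡ-≤ 0 (∸-monoʳ-≤ (length xs) (s≤s {0} {1} z≤n))))
    pascal (suc j) []           = z≤n
    pascal (suc j) (y ∷ [])     = z≤n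
    pascal (suc j) (y ∷ z ∷ zs) = C-pascal-bound (collisionPairs (y ∷ z ∷ zs)) (length zs) j
      (collidingSubwords-bound j (y ∷ z ∷ zs)) (collidingSubwords-bound (suc j) (y ∷ z ∷ zs))

  sumClassSizes : List ℕ → List ℕ → ℕ
  sumClassSizes l w = sum (map (λ y → classSize (h y) w) l)

  sumClassSizes-∷ : ∀ l x w → sumClassSizes l (x ∷ w) ≡ sumClassSizes l w + classSize (h x) l
  sumClassSizes-∷ []      x w = refl
  sumClassSizes-∷ (y ∷ l) x w
    rewrite count-∷ (λ z → h z ≡ᵇ h y) x w | sumClassSizes-∷ l x w
          | count-∷ (λ z → h z ≡ᵇ h x) y l | ≡ᵇ-sym (h x) (h y) =
    shuffle (indicator (h y ≡ᵇ h x)) (classSize (h y) w) (sumClassSizes l w) (classSize (h x) l)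
    where
    shuffle : ∀ a b c d → a + b + (c + d) ≡ b + c + (a + d)
    shuffle = solve-∀

  -- Σ_y |class of y| counts each ordered pair of same-class positions, the diagonal included.
  sumClassSizes-self : ∀ w → sumClassSizes w w ≡ 2 * collisionPairs w + length w
  sumClassSizes-self []      = refl
  sumClassSizes-self (x ∷ w)
    rewrite count-∷ (λ z → h z ≡ᵇ h x) x w | ≡ᵇ-refl (h x) | sumClassSizes-∷ w x w | sumClassSizes-self w =
    shuffle (classSize (h x) w) (collisionPairs w) (length w)
    where
    shuffle : ∀ a b c → suc (a + (2 * b + c + a)) ≡ 2 * (a + b) + suc c
    shuffle = solve-∀

  sumClassSizes-≤ : ∀ q w l → (∀ c → classSize c w ≤ q) → sumClassSizes l w ≤ q * length l
  sumClassSizes-≤ q w []      _ = z≤n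
  sumClassSizes-≤ q w (y ∷ l) classSize≤q = begin
    classSize (h y) w + sumClassSizes l w ≤⟨ +-mono-≤ (classSize≤q (h y)) (sumClassSizes-≤ q w l classSize≤q) ⟩
    q + q * length l                      ≡⟨ sym (*-suc q (length l)) ⟩
    q * suc (length l)                    ∎
    where open ≤-Reasoning

  collisionPairs-bound : ∀ q w → (∀ c → classSize c w ≤ q) → 2 * collisionPairs w + length w ≤ q * length w
  collisionPairs-bound q w classSize≤q = subst (_≤ q * length w) (sumClassSizes-self w) (sumClassSizes-≤ q w w classSize≤q)

module _ {h : ℕ → ℕ} (h-mono : ∀ {a b} → a ≤ b → h a ≤ h b) where

  private
    reflect-≤ : ∀ {x y} → h x ≤ h y → h x ≢ h y → x ≤ y
    reflect-≤ {x} {y} hx≤hy hx≢hy with ≤-total x y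
    ... | inj₁ x≤y = x≤y
    ... | inj₂ y≤x = ⊥-elim (hx≢hy (≤-antisym hx≤hy (h-mono y≤x)))

    head-distinct : ∀ x y xs → ¬ T (hasCollision h (x ∷ y ∷ xs)) → h y ≢ h x
    head-distinct x y xs free hy≡hx = free (from T-∨ (inj₁ (from T-∨ (inj₁ (≡⇒≡ᵇ (h y) (h x) hy≡hx)))))

    tail-free : ∀ x xs → ¬ T (hasCollision h (x ∷ xs)) → ¬ T (hasCollision h xs)
    tail-free x xs free c = free (from T-∨ (inj₂ c))

  nondecr-map⁻ : ∀ u → ¬ T (hasCollision h u) → T (nondecr (map h u)) → T (nondecr u)
  nondecr-map⁻ []           _    _  = _
  nondecr-map⁻ (x ∷ [])     _    _  = _
  nondecr-map⁻ (x ∷ y ∷ xs) free nd = from T-∧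
    ( ≤⇒≤ᵇ (reflect-≤ (≤ᵇ⇒≤ (h x) (h y) (proj₁ (to T-∧ nd))) (head-distinct x y xs free ∘ sym))
    , nondecr-map⁻ (y ∷ xs) (tail-free x (y ∷ xs) free) (proj₂ (to T-∧ nd)) )

  nonincr-map⁻ : ∀ u → ¬ T (hasCollision h u) → T (nonincr (map h u)) → T (nonincr u)
  nonincr-map⁻ []           _    _  = _
  nonincr-map⁻ (x ∷ [])     _    _  = _
  nonincr-map⁻ (x ∷ y ∷ xs) free ni = from T-∧
    ( ≤⇒≤ᵇ (reflect-≤ (≤ᵇ⇒≤ (h y) (h x) (proj₁ (to T-∧ ni))) (head-distinct x y xs free))
    , nonincr-map⁻ (y ∷ xs) (tail-free x (y ∷ xs) free) (proj₂ (to T-∧ ni)) )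

  monotone-map⁻ : ∀ u → ¬ T (hasCollision h u) → T (monotone (map h u)) → T (monotone u)
  monotone-map⁻ u free mono with to T-∨ mono
  ... | inj₁ nd = from T-∨ (inj₁ (nondecr-map⁻ u free nd))
  ... | inj₂ ni = from T-∨ (inj₂ (nonincr-map⁻ u free ni))

  m-map-≤ : ∀ k w → m k (map h w) ≤ m k w + collidingSubwords h k w
  m-map-≤ k w = begin
    m k (map h w)
      ≡⟨ cong (count monotoneOfLength) (subwords-map h w) ⟩
    count monotoneOfLength (map (map h) (subwords w))
      ≡⟨ count-map monotoneOfLength (map h) (subwords w) ⟩
    count (monotoneOfLength ∘ map h) (subwords w)
      ≤⟨ count-mono monotone-or-colliding (subwords w) ⟩
    count (λ u → monotoneOfLength u ∨ (lenIs k u ∧ hasCollision h u)) (subwords w)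
      ≤⟨ count-∨ monotoneOfLength (λ u → lenIs k u ∧ hasCollision h u) (subwords w) ⟩
    m k w + collidingSubwords h k w ∎
    where
    open ≤-Reasoning
    monotoneOfLength : List ℕ → Bool
    monotoneOfLength u = lenIs k u ∧ monotone u
    monotone-or-colliding : ∀ u → T (monotoneOfLength (map h u)) → T (monotoneOfLength u ∨ (lenIs k u ∧ hasCollision h u))
    monotone-or-colliding u t with to T-∧ t | T? (hasCollision h u)
    ... | len , mono | yes c    = from T-∨ (inj₂ (from T-∧ (subst T (lenIs-map h k u) len , c)))
    ... | len , mono | no  free = from T-∨ (inj₁ (from T-∧ (subst T (lenIs-map h k u) len , monotone-map⁻ u free mono)))

insertions-↭ : ∀ x ys {zs} → zs ∈ insertions x ys → zs ↭ x ∷ ys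
insertions-↭ x []       (here refl) = ↭-refl
insertions-↭ x (y ∷ ys) (here refl) = ↭-refl
insertions-↭ x (y ∷ ys) (there zs∈) with ∈-map⁻ (y ∷_) zs∈
... | zs′ , zs′∈ , refl = ↭-trans (prep y (insertions-↭ x ys zs′∈)) (swap y x ↭-refl)

perms-↭ : ∀ xs {π} → π ∈ perms xs → π ↭ xs
perms-↭ []       (here refl) = ↭-refl
perms-↭ (x ∷ xs) π∈ with find (∈-concatMap⁻ (insertions x) {xs = perms xs} π∈)
... | σ , σ∈ , π∈insertions = ↭-trans (insertions-↭ x σ π∈insertions) (prep x (perms-↭ xs σ∈))

∈-perms : ∀ xs → xs ∈ perms xs
∈-perms []       = here refl
∈-perms (x ∷ xs) = ∈-concatMap⁺ (insertions x) (lose (∈-perms xs) (∷-∈-insertions xs))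
  where
  ∷-∈-insertions : ∀ ys → x ∷ ys ∈ insertions x ys
  ∷-∈-insertions []      = here refl
  ∷-∈-insertions (_ ∷ _) = here refl

∈-words : ∀ s n w → length w ≡ n → (∀ {v} → v ∈ w → v < s) → w ∈ words s n
∈-words s zero    []      _      _       = here refl
∈-words s (suc n) (x ∷ w) |w|≡1+n letters =
  ∈-concatMap⁺ (λ a → map (a ∷_) (words s n))
    (lose (∈-upTo⁺ (letters (here refl)))
          (∈-map⁺ (x ∷_) (∈-words s n w (suc-injective |w|≡1+n) (letters ∘ there))))

module _ {A : Set} (φ : A → ℕ) where

  minList-≤ : ∀ {xs y} → y ∈ xs → minList (map φ xs) ≤ φ y
  minList-≤ {x ∷ []}     (here refl) = ≤-refl
  minList-≤ {x ∷ _ ∷ _}  (here refl) = m⊓n≤m (φ x) _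
  minList-≤ {x ∷ x′ ∷ _} (there y∈)  = ≤-trans (m⊓n≤n (φ x) _) (minList-≤ y∈)

  minList-attained : ∀ {xs y} → y ∈ xs → ∃[ x ] (x ∈ xs × minList (map φ xs) ≡ φ x)
  minList-attained {x ∷ []}      _ = x , here refl , refl
  minList-attained {x ∷ x′ ∷ xs} _
    with minList-attained {x′ ∷ xs} (here refl) | ⊓-sel (φ x) (minList (map φ (x′ ∷ xs)))
  ... | _                  | inj₁ min≡φx   = x , here refl , min≡φx
  ... | z , z∈ , rest≡φz | inj₂ min≡rest = z , there z∈ , trans min≡rest rest≡φz

m<n+[m/n]*n : ∀ m n .{{_ : NonZero n}} → m < n + m / n * n
m<n+[m/n]*n m n = begin-strict
  m                   ≡⟨ m≡m%n+[m/n]*n m n ⟩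
  m % n + m / n * n   <⟨ +-monoˡ-< (m / n * n) (m%n<n m n) ⟩
  n + m / n * n       ∎
  where open ≤-Reasoning

module _ (q : ℕ) .{{_ : NonZero q}} where

  /-class-bounds : ∀ {v c} → (v / q ≡ᵇ c) ≡ true → c * q ≤ v × v < c * q + q
  /-class-bounds {v} {c} v∈c with ≡ᵇ⇒≡ (v / q) c (subst T (sym v∈c) _)
  ... | refl = m/n*n≤m v q , subst (v <_) (+-comm q (v / q * q)) (m<n+[m/n]*n v q)

  classSize-/-upTo-suc : ∀ c n → classSize (_/ q) c (upTo (suc n)) ≡ classSize (_/ q) c (upTo n) + indicator (n / q ≡ᵇ c)
  classSize-/-upTo-suc c n = begin
    classSize (_/ q) c (upTo (suc n))                          ≡⟨ cong (classSize (_/ q) c) (sym (upTo-∷ʳ n)) ⟩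
    classSize (_/ q) c (upTo n ++ n ∷ [])                      ≡⟨ count-++ (λ y → y / q ≡ᵇ c) (upTo n) (n ∷ []) ⟩
    classSize (_/ q) c (upTo n) + classSize (_/ q) c (n ∷ [])  ≡⟨ cong (classSize (_/ q) c (upTo n) +_) (count-∷ (λ y → y / q ≡ᵇ c) n []) ⟩
    classSize (_/ q) c (upTo n) + (indicator (n / q ≡ᵇ c) + 0) ≡⟨ cong (classSize (_/ q) c (upTo n) +_) (+-identityʳ _) ⟩
    classSize (_/ q) c (upTo n) + indicator (n / q ≡ᵇ c)       ∎
    where open ≡-Reasoning

  classSize-/-upTo-≤-∸ : ∀ c n → classSize (_/ q) c (upTo n) ≤ n ∸ c * q
  classSize-/-upTo-≤-∸ c zero    = z≤n
  classSize-/-upTo-≤-∸ c (suc n) = begin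
    classSize (_/ q) c (upTo (suc n))                    ≡⟨ classSize-/-upTo-suc c n ⟩
    classSize (_/ q) c (upTo n) + indicator (n / q ≡ᵇ c) ≤⟨ last-step ⟩
    suc n ∸ c * q                                        ∎
    where
    open ≤-Reasoning
    IH = classSize-/-upTo-≤-∸ c n
    last-step : classSize (_/ q) c (upTo n) + indicator (n / q ≡ᵇ c) ≤ suc n ∸ c * q
    last-step with n / q ≡ᵇ c in n∈c
    ... | true  = ≤-trans (≤-reflexive (+-comm _ 1))
                    (≤-trans (s≤s IH) (≤-reflexive (sym (+-∸-assoc 1 (proj₁ (/-class-bounds n∈c))))))
    ... | false = ≤-trans (≤-reflexive (+-identityʳ _)) (≤-trans IH (∸-monoˡ-≤ (c * q) (n≤1+n n)))

  classSize-/-upTo-≤ : ∀ c n → classSize (_/ q) c (upTo n) ≤ q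
  classSize-/-upTo-≤ c zero    = z≤n
  classSize-/-upTo-≤ c (suc n) with n / q ≡ᵇ c in n∈c
  ... | true  = ≤-trans (classSize-/-upTo-≤-∸ c (suc n)) (m≤n+o⇒m∸n≤o (suc n) (c * q) (proj₂ (/-class-bounds n∈c)))
  ... | false = begin
    classSize (_/ q) c (upTo (suc n))                    ≡⟨ classSize-/-upTo-suc c n ⟩
    classSize (_/ q) c (upTo n) + indicator (n / q ≡ᵇ c) ≡⟨ cong (λ b → classSize (_/ q) c (upTo n) + indicator b) n∈c ⟩
    classSize (_/ q) c (upTo n) + 0                      ≡⟨ +-identityʳ _ ⟩
    classSize (_/ q) c (upTo n)                          ≤⟨ classSize-/-upTo-≤ c n ⟩
    q                                                    ∎
    where open ≤-Reasoning

ratio-nonneg : ∀ a b → 0ℚ ℚ.≤ ratio a b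
ratio-nonneg a zero    = ℚ.≤-refl
ratio-nonneg a (suc b) = ℚ.nonNegative⁻¹ _ {{ℚ.normalize-nonNeg a (suc b)}}

≤-+-nonneg : ∀ p {x} → 0ℚ ℚ.≤ x → p ℚ.≤ p ℚ.+ x
≤-+-nonneg p 0≤x = ℚ.≤-trans (ℚ.≤-reflexive (sym (ℚ.+-identityʳ p))) (ℚ.+-monoʳ-≤ p 0≤x)

ratio-≤-+ : ∀ A M K a b → A * suc b ≤ M * suc b + K * a → ratio A a ℚ.≤ ratio M a ℚ.+ ratio K (suc b)
ratio-≤-+ A M K zero    b _  = ℚ.≤-trans (ratio-nonneg K (suc b)) (ℚ.≤-reflexive (sym (ℚ.+-identityˡ _)))
ratio-≤-+ A M K (suc a) b le = ℚ.toℚᵘ-cancel-≤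
  (ℚᵘ.≤-respˡ-≃ (ℚᵘ.≃-sym (toℚᵘ-ratio A a))
    (ℚᵘ.≤-respʳ-≃ (ℚᵘ.≃-sym (ℚᵘ.≃-trans (ℚ.toℚᵘ-homo-+ (ratio M (suc a)) (ratio K (suc b)))
                                          (ℚᵘ.+-cong (toℚᵘ-ratio M a) (toℚᵘ-ratio K b))))
      (ℚᵘ.*≤* (subst₂ ℤ._≤_ (ℤ.pos-* A _) cross (ℤ.+≤+ scaled)))))
  where
  toℚᵘ-ratio : ∀ x d → toℚᵘ (ratio x (suc d)) ℚᵘ.≃ ℚᵘ.mkℚᵘ (ℤ.+ x) d
  toℚᵘ-ratio x d = ℚ.toℚᵘ-fromℚᵘ (ℚᵘ.mkℚᵘ (ℤ.+ x) d)
  scaled : A * (suc a * suc b) ≤ (M * suc b + K * suc a) * suc a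
  scaled = subst (_≤ (M * suc b + K * suc a) * suc a) (reassoc A (suc a) (suc b)) (*-monoˡ-≤ (suc a) le)
    where
    reassoc : ∀ x y z → x * z * y ≡ x * (y * z)
    reassoc = solve-∀
  cross : ℤ.+ ((M * suc b + K * suc a) * suc a) ≡ (ℤ.+ M ℤ.* ℤ.+ suc b ℤ.+ ℤ.+ K ℤ.* ℤ.+ suc a) ℤ.* ℤ.+ suc a
  cross = trans (ℤ.pos-* (M * suc b + K * suc a) (suc a))
            (cong (ℤ._* ℤ.+ suc a) (trans (ℤ.pos-+ (M * suc b) (K * suc a))
                                          (cong₂ ℤ._+_ (ℤ.pos-* M (suc b)) (ℤ.pos-* K (suc a)))))

collision-term-≤ : ∀ j n P d s → 2 * P ≤ d * suc (suc n) → s * d ≤ suc n →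
  P * (n C j) * s ≤ (suc (suc j) C 2) * (suc (suc n) C suc (suc j))
collision-term-≤ j n P d s 2P≤dN sd≤n+1 = *-cancelˡ-≤ 2 (begin
  2 * (P * (n C j) * s)                  ≡⟨ regroup₁ P (n C j) s ⟩
  2 * P * s * (n C j)                    ≤⟨ *-monoˡ-≤ (n C j) (*-monoˡ-≤ s 2P≤dN) ⟩
  d * N * s * (n C j)                    ≡⟨ regroup₂ d N s (n C j) ⟩
  s * d * N * (n C j)                    ≤⟨ *-monoˡ-≤ (n C j) (*-monoˡ-≤ N sd≤n+1) ⟩
  suc n * N * (n C j)                    ≡⟨ cong (_* (n C j)) (*-comm (suc n) N) ⟩
  N * suc n * (n C j)                    ≡⟨ C-two-absorptions n j ⟩
  k * suc j * (N C k)                    ≡⟨ cong (_* (N C k)) (sym (two-*-C2 j)) ⟩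
  2 * (k C 2) * (N C k)                  ≡⟨ *-assoc 2 (k C 2) (N C k) ⟩
  2 * ((k C 2) * (N C k))                ∎)
  where
  open ≤-Reasoning
  k = suc (suc j)
  N = suc (suc n)
  regroup₁ : ∀ a b c → 2 * (a * b * c) ≡ 2 * a * c * b
  regroup₁ = solve-∀
  regroup₂ : ∀ a b c e → a * b * c * e ≡ c * a * b * e
  regroup₂ = solve-∀

compress-∈-words : ∀ s .{{_ : NonZero s}} n {π} → π ↭ upTo (suc n) → map (_/ suc (n / s)) π ∈ words s (suc n)
compress-∈-words s n {π} π↭ = ∈-words s (suc n) (map (_/ q) π) (trans (length-map (_/ q) π) |π|≡) letters
  where
  q = suc (n / s)
  |π|≡ : length π ≡ suc n
  |π|≡ = trans (↭-length π↭) (length-upTo (suc n))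
  letters : ∀ {v} → v ∈ map (_/ q) π → v < s
  letters v∈ with ∈-map⁻ (_/ q) v∈
  ... | u , u∈π , refl = m<n*o⇒m/o<n (subst (u <_) (*-comm q s)
                                  (≤-<-trans (s≤s⁻¹ (∈-upTo⁻ (∈-resp-↭ π↭ u∈π))) (m<n+[m/n]*n n s)))

2*collisionPairs-≤ : ∀ d N {π} → π ↭ upTo N → 2 * collisionPairs (_/ suc d) π ≤ d * N
2*collisionPairs-≤ d N {π} π↭ = +-cancelˡ-≤ N _ _ (begin
  N + 2 * P                  ≡⟨ +-comm N (2 * P) ⟩
  2 * P + N                  ≡⟨ cong (2 * P +_) (sym |π|≡N) ⟩
  2 * P + length π           ≤⟨ collisionPairs-bound (_/ suc d) (suc d) π classes≤q ⟩
  suc d * length π           ≡⟨ cong (suc d *_) |π|≡N ⟩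
  N + d * N                  ∎)
  where
  open ≤-Reasoning
  P = collisionPairs (_/ suc d) π
  |π|≡N : length π ≡ N
  |π|≡N = trans (↭-length π↭) (length-upTo N)
  classes≤q : ∀ c → classSize (_/ suc d) c π ≤ suc d
  classes≤q c = ≤-trans (≤-reflexive (count-↭ (λ y → y / suc d ≡ᵇ c) π↭)) (classSize-/-upTo-≤ (suc d) c N)

m-compress-≤ : ∀ j t n {π} → π ↭ upTo (suc (suc n)) →
  let k = suc (suc j) ; s = suc t ; N = suc (suc n) in
  m k (map (_/ suc (suc n / s)) π) * s ≤ m k π * s + (k C 2) * (N C k)
m-compress-≤ j t n {π} π↭ = begin
  m k (map h π) * s                                    ≤⟨ *-monoˡ-≤ s (m-map-≤ (/-monoˡ-≤ q) k π) ⟩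
  (m k π + collidingSubwords h k π) * s                ≡⟨ *-distribʳ-+ s (m k π) _ ⟩
  m k π * s + collidingSubwords h k π * s              ≤⟨ +-monoʳ-≤ (m k π * s) (*-monoˡ-≤ s (collidingSubwords-bound h j π)) ⟩
  m k π * s + P * ((length π ∸ 2) C j) * s             ≡⟨ cong (λ ℓ → m k π * s + P * ((ℓ ∸ 2) C j) * s) |π|≡N ⟩
  m k π * s + P * (n C j) * s                          ≤⟨ +-monoʳ-≤ (m k π * s) (collision-term-≤ j n P d s 2P≤dN sd≤n+1) ⟩
  m k π * s + (k C 2) * (N C k)                        ∎
  where
  open ≤-Reasoning
  k = suc (suc j)
  s = suc t
  N = suc (suc n)
  d = suc n / s
  q = suc d
  h : ℕ → ℕ
  h v = v / q
  P = collisionPairs h π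
  |π|≡N : length π ≡ N
  |π|≡N = trans (↭-length π↭) (length-upTo N)
  2P≤dN : 2 * P ≤ d * N
  2P≤dN = 2*collisionPairs-≤ d N π↭
  sd≤n+1 : s * d ≤ suc n
  sd≤n+1 = ≤-trans (≤-reflexive (*-comm s d)) (m/n*n≤m (suc n) s)

compression-bound : ∀ j t n →
  let k = suc (suc j) ; s = suc t ; N = suc (suc n) in
  minList (map (m k) (words s N)) * s ≤ minList (map (m k) (perms (upTo N))) * s + (k C 2) * (N C k)
compression-bound j t n with minList-attained (m (suc (suc j))) (∈-perms (upTo (suc (suc n))))
... | π , π∈ , M≡mπ = begin
  minList (map (m k) (words s N)) * s          ≤⟨ *-monoˡ-≤ s (minList-≤ (m k) (compress-∈-words s (suc n) π↭)) ⟩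
  m k (map (_/ suc (suc n / s)) π) * s         ≤⟨ m-compress-≤ j t n π↭ ⟩
  m k π * s + (k C 2) * (N C k)                ≡⟨ cong (λ M → M * s + (k C 2) * (N C k)) (sym M≡mπ) ⟩
  minList (map (m k) (perms (upTo N))) * s + (k C 2) * (N C k) ∎
  where
  open ≤-Reasoning
  k = suc (suc j)
  s = suc t
  N = suc (suc n)
  π↭ = perms-↭ (upTo N) π∈

f≤g+C2/s : ∀ j t n →
  f (suc t) (suc (suc j)) (suc (suc n)) ℚ.≤ g (suc (suc j)) (suc (suc n)) ℚ.+ ratio (suc (suc j) C 2) (suc t)
f≤g+C2/s j t n = ratio-≤-+ (minList (map (m k) (words s N))) (minList (map (m k) (perms (upTo N)))) (k C 2) (N C k) t
                             (compression-bound j t n)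
  where
  k = suc (suc j)
  s = suc t
  N = suc (suc n)

proposition5p2 : (k : ℕ) → k ≥ 3 →
    ∃[ c ] ∃[ S ] ((s : ℕ) → s ≥ S → s ≥ 1 → (e : ℕ) → ∃[ N ] ((n : ℕ) → n ≥ N →
      f s k n ℚ.≤ g k n ℚ.+ ratio (k C 2) s ℚ.+ ratio c (s * s) ℚ.+ ratio 1 (suc e)))
proposition5p2 (suc (suc j)) (s≤s (s≤s (s≤s _))) = 0 , 1 , bound
  where
  bound : (s : ℕ) → s ≥ 1 → s ≥ 1 → (e : ℕ) → ∃[ N ] ((n : ℕ) → n ≥ N →
    f s (suc (suc j)) n ℚ.≤ g (suc (suc j)) n ℚ.+ ratio (suc (suc j) C 2) s ℚ.+ ratio 0 (s * s) ℚ.+ ratio 1 (suc e))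
  bound (suc t) _ _ e = 2 , λ where
    (suc zero)    (s≤s ())
    (suc (suc n)) _        → ℚ.≤-trans (f≤g+C2/s j t n)
      (ℚ.≤-trans (≤-+-nonneg _ (ratio-nonneg 0 (suc t * suc t))) (≤-+-nonneg _ (ratio-nonneg 1 (suc e))))
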